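{- Let $\mathbf{A}$ be a relational structure and $k\geq0$. Then the following are equivalent: (1) $\mathbf{A}$ is $k$-polylocal; (2) $\mathbf{A}$ is algebraic and for all $m\geq1$ and all finite $\tau\subseteq A^m$ we have $(\operatorname{Tpp}_{\mathbf{A}}(\tau))^{\mathbf{A}}=(\operatorname{Tpp}^{(k)}_{\mathbf{A}}(\tau))^{\mathbf{A}}$.
   Context: A positive primitive (pp) formula is $\exists y_1\dots\exists y_j\,\psi$ with $\psi$ a conjunction of atomic formulae of the signature of $\mathbf{A}$; $\varphi(x_1,\dots,x_m)$ defines $\varphi^{\mathbf{A}}\subseteq A^m$. For $\varrho\subseteq A^m$, $\operatorname{Tpp}_{\mathbf{A}}(\varrho)$ is the set of pp formulae $\varphi(x_1,\dots,x_m)$ with $\varrho\subseteq\varphi^{\mathbf{A}}$; for a set $\Psi$ of such formulae $\Psi^{\mathbf{A}}=\bigcap_{\varphi\in\Psi}\varphi^{\mathbf{A}}$. $\Psi^{(k)}$ is the set of formulae of $\Psi$ logically equivalent to some $\exists x_{m+1}\dots\exists x_{m+k}\,\psi(x_1,\dots,x_{m+k})$ with $\psi$ a conjunction of atoms, and $\operatorname{Tpp}^{(k)}_{\mathbf{A}}(\tau)=(\operatorname{Tpp}_{\mathbf{A}}(\tau))^{(k)}$. $\overline{[\mathbf{A}]^{(m)}_{RA}}$ is the closure system of all relations of the form $\Psi^{\mathbf{A}}$ ($\Psi$ a set of pp formulae in $x_1,\dots,x_m$). $\mathbf{A}$ is algebraic if each $\overline{[\mathbf{A}]^{(m)}_{RA}}$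 is an algebraic closure system (equivalently closed under unions of upward directed families). $\mathbf{A}$ is $k$-polylocal if for every $m$ and every $\sigma\subseteq A^m$: $\sigma\in\overline{[\mathbf{A}]^{(m)}_{RA}}$ iff for every finite $\tau\subseteq\sigma$ and every $\bar b\in A^m$, $\operatorname{Tpp}^{(k)}_{\mathbf{A}}(\tau)\subseteq\operatorname{Tpp}^{(k)}_{\mathbf{A}}(\{\bar b\})$ implies $\bar b\in\sigma$. -}

module Defs where

open import Level using (Level; _⊔_) renaming (suc to lsuc; zero to lzero)
open import Data.Nat using (ℕ; suc; _+_)
open import Data.Fin using (Fin)
open import Data.Vec using (Vec; lookup; map; _++_)
open import Data.List using (List)
open import Data.List.Relation.Unary.All using (All)
open import Data.List.Membership.Propositional using (_∈_)
open import Data.Product using (Σ; _×_; ∃)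
open import Relation.Binary.PropositionalEquality using (_≡_)

record Signature : Set₁ where
  field
    Sym : Set
    ar  : Sym → ℕ
open Signature public

record Structure (S : Signature) : Set₁ where
  field
    Carrier : Set
    rel     : (r : Sym S) → Vec Carrier (ar S r) → Set
open Structure public

Rel : Set → ℕ → (ℓ : Level) → Set (lsuc ℓ)
Rel X m ℓ = Vec X m → Set ℓ

_⊆ᴿ_ : ∀ {X m ℓ₁ ℓ₂} → Rel X m ℓ₁ → Rel X m ℓ₂ → Set (ℓ₁ ⊔ ℓ₂)
σ ⊆ᴿ ρ = ∀ a → σ a → ρ a

_≐_ : ∀ {X m ℓ₁ ℓ₂} → Rel X m ℓ₁ → Rel X m ℓ₂ → Set (ℓ₁ ⊔ ℓ₂)
σ ≐ ρ = (σ ⊆ᴿ ρ) × (ρ ⊆ᴿ σ)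

data Atom (S : Signature) (n : ℕ) : Set where
  relAt : (r : Sym S) → Vec (Fin n) (ar S r) → Atom S n
  eqAt  : Fin n → Fin n → Atom S n

-- pp formula φ(x_1,…,x_m) = ∃ y_1 … ∃ y_nb . (conjunction of atoms)
-- free variables are the first m positions, bound ones the last nb.
record PP (S : Signature) (m : ℕ) : Set where
  constructor pp
  field
    nb    : ℕ
    atoms : List (Atom S (m + nb))
open PP public

holds : ∀ {S n} (B : Structure S) → Vec (Carrier B) n → Atom S n → Set
holds B v (relAt r xs) = rel B r (map (lookup v) xs)
holds B v (eqAt i j)   = lookup v i ≡ lookup v j

⟦_⟧ : ∀ {S m} → PP S m → (B : Structure S) → Rel (Carrier B) m lzero
⟦ φ ⟧ B a = Σ (Vec (Carrier B) (nb φ)) λ b → All (holds B (a ++ b)) (atoms φ)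

LogEquiv : ∀ {S m} → PP S m → PP S m → Set₁
LogEquiv {S} φ ψ = (B : Structure S) → ⟦ φ ⟧ B ≐ ⟦ ψ ⟧ B

FSet : Signature → ℕ → (ℓ : Level) → Set (lsuc ℓ)
FSet S m ℓ = PP S m → Set ℓ

_^_ : ∀ {S m ℓ} → FSet S m ℓ → (A : Structure S) → Rel (Carrier A) m ℓ
(Ψ ^ A) a = ∀ φ → Ψ φ → ⟦ φ ⟧ A a

_⁽_⁾ : ∀ {S m ℓ} → FSet S m ℓ → ℕ → FSet S m (lsuc lzero ⊔ ℓ)
(Ψ ⁽ k ⁾) φ = Ψ φ × Σ (PP _ _) λ ψ → (nb ψ ≡ k) × LogEquiv φ ψ

Tpp : ∀ {S m ℓ} (A : Structure S) → Rel (Carrier A) m ℓ → FSet S m ℓ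
Tpp A ϱ φ = ϱ ⊆ᴿ ⟦ φ ⟧ A

Tppk : ∀ {S m ℓ} (A : Structure S) → ℕ → Rel (Carrier A) m ℓ → FSet S m (lsuc lzero ⊔ ℓ)
Tppk A k ϱ = Tpp A ϱ ⁽ k ⁾

fin : ∀ {X m} → List (Vec X m) → Rel X m lzero
fin τ a = a ∈ τ

sing : ∀ {X m} → Vec X m → Rel X m lzero
sing b a = a ≡ b

-- The closure system of relations Ψ^A (arity m ≥ 1, written suc m)

InClosure : ∀ {S} (A : Structure S) (m : ℕ) → Rel (Carrier A) (suc m) lzero → Set₁
InClosure {S} A m σ = Σ (FSet S (suc m) lzero) λ Ψ → σ ≐ (Ψ ^ A)

Algebraic : ∀ {S} → Structure S → Set₁
Algebraic A =
  ∀ (m : ℕ) (I : Set) (σ : I → Rel (Carrier A) (suc m) lzero) →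
  I →                                                     -- nonempty
  (∀ i j → Σ I λ l → (σ i ⊆ᴿ σ l) × (σ j ⊆ᴿ σ l)) →
  (∀ i → InClosure A m (σ i)) →
  InClosure A m (λ a → Σ I λ i → σ i a)

Polylocal : ∀ {S} → Structure S → ℕ → Set₁
Polylocal A k =
  ∀ (m : ℕ) (σ : Rel (Carrier A) (suc m) lzero) →
    InClosure A m σ
    ⇔' (∀ (τ : List (Vec (Carrier A) (suc m))) → All σ τ →
        ∀ (b : Vec (Carrier A) (suc m)) →
        (∀ φ → Tppk A k (fin τ) φ → Tppk A k (sing b) φ) → σ b)
  where
  _⇔'_ : Set₁ → Set₁ → Set₁
  P ⇔' Q = (P → Q) × (Q → P)

-- Tpp(τ)^A is the least closed relation containing τ, and b ∈ Tppk(τ)^A says exactly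
-- Tppk(τ) ⊆ Tppk({b}). So k-polylocality asks that closed relations be those containing
-- Tppk(τ)^A for every finite τ inside them. Applied to the closed relation Tpp(τ)^A this
-- forces Tpp(τ)^A = Tppk(τ)^A; and a relation with that finite property is the directed
-- union of the closed relations Tpp(τ)^A over its finite subsets, closed by algebraicity.
module Submission where

open import Level using (Level) renaming (zero to lzero)
open import Defs
open import Data.Nat using (ℕ; suc)
open import Data.Vec using (Vec)
open import Data.List using (List; []; _∷_; _++_)
open import Data.List.Relation.Unary.All as All using (All; []; _∷_)
open import Data.List.Relation.Unary.All.Properties using (++⁺)
open import Data.List.Relation.Unary.Any using (here)
open import Data.List.Membership.Propositional.Properties using (∈-++⁺ˡ; ∈-++⁺ʳ)
open import Data.Product using (_×_; _,_; proj₁; proj₂; Σ)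
open import Function.Bundles using (_⇔_; mk⇔; Equivalence)
open import Relation.Binary.PropositionalEquality using (refl; subst; sym)

All-directed-⋃ : ∀ {X I : Set} {ℓ : Level} (σ : I → X → Set ℓ) → I →
  (∀ i j → Σ I λ l → (∀ a → σ i a → σ l a) × (∀ a → σ j a → σ l a)) →
  ∀ τ → All (λ a → Σ I λ i → σ i a) τ → Σ I λ l → All (σ l) τ
All-directed-⋃ σ i₀ directed []      []                = i₀ , []
All-directed-⋃ σ i₀ directed (a ∷ τ) ((i , a∈σi) ∷ τ⊆⋃)
  with All-directed-⋃ σ i₀ directed τ τ⊆⋃
... | l , τ⊆σl with directed i l
...   | l′ , σi⊆σl′ , σl⊆σl′ = l′ , σi⊆σl′ a a∈σi ∷ All.map (λ {b} → σl⊆σl′ b) τ⊆σl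

InClosure-resp-≐ : ∀ {S} {A : Structure S} {m} {σ ρ : Rel (Carrier A) (suc m) lzero} →
  σ ≐ ρ → InClosure A m ρ → InClosure A m σ
InClosure-resp-≐ (σ⊆ρ , ρ⊆σ) (Ψ , ρ⊆Ψ , Ψ⊆ρ) =
  Ψ , (λ a a∈σ → ρ⊆Ψ a (σ⊆ρ a a∈σ)) , (λ a a∈Ψ → ρ⊆σ a (Ψ⊆ρ a a∈Ψ))

module _ {S : Signature} (A : Structure S) where

  Tpp^-closed : ∀ m (ρ : Rel (Carrier A) (suc m) lzero) → InClosure A m (Tpp A ρ ^ A)
  Tpp^-closed m ρ = Tpp A ρ , (λ _ a∈ → a∈) , (λ _ a∈ → a∈)

  ⊆-Tpp^ : ∀ {m ℓ} (ρ : Rel (Carrier A) m ℓ) → ρ ⊆ᴿ (Tpp A ρ ^ A)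
  ⊆-Tpp^ ρ a a∈ρ φ ρ⊆φ = ρ⊆φ a a∈ρ

  Tpp^-mono : ∀ {m ℓ₁ ℓ₂} {ρ : Rel (Carrier A) m ℓ₁} {ρ′ : Rel (Carrier A) m ℓ₂} →
    ρ ⊆ᴿ ρ′ → (Tpp A ρ ^ A) ⊆ᴿ (Tpp A ρ′ ^ A)
  Tpp^-mono ρ⊆ρ′ a a∈ φ ρ′⊆φ = a∈ φ (λ x x∈ρ → ρ′⊆φ x (ρ⊆ρ′ x x∈ρ))

  Tpp^-least : ∀ {m ℓ₁ ℓ₂} {ρ : Rel (Carrier A) m ℓ₁} {Ψ : FSet S m ℓ₂} →
    ρ ⊆ᴿ (Ψ ^ A) → (Tpp A ρ ^ A) ⊆ᴿ (Ψ ^ A)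
  Tpp^-least ρ⊆Ψ a a∈ φ φ∈Ψ = a∈ φ (λ x x∈ρ → ρ⊆Ψ x x∈ρ φ φ∈Ψ)

  Tpp^⊆Tppk^ : ∀ {m ℓ} k (ρ : Rel (Carrier A) m ℓ) → (Tpp A ρ ^ A) ⊆ᴿ (Tppk A k ρ ^ A)
  Tpp^⊆Tppk^ k ρ a a∈ φ φ∈Tppk = a∈ φ (proj₁ φ∈Tppk)

  Tppk^⇔Tppk-⊆-sing : ∀ {m ℓ} k (ρ : Rel (Carrier A) m ℓ) b →
    (Tppk A k ρ ^ A) b ⇔ (∀ φ → Tppk A k ρ φ → Tppk A k (sing b) φ)
  Tppk^⇔Tppk-⊆-sing k ρ b = mk⇔
    (λ b∈ φ φ∈Tppk → (λ a a≡b → subst (⟦ φ ⟧ A) (sym a≡b) (b∈ φ φ∈Tppk)) , proj₂ φ∈Tppk)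
    (λ ⊆sing φ φ∈Tppk → proj₁ (⊆sing φ φ∈Tppk) b refl)

  LocallyClosed : ℕ → ∀ {m} → Rel (Carrier A) m lzero → Set₁
  LocallyClosed k {m} σ =
    ∀ (τ : List (Vec (Carrier A) m)) → All σ τ →
    ∀ b → (∀ φ → Tppk A k (fin τ) φ → Tppk A k (sing b) φ) → σ b

  LocallyClosed-⋃-directed : ∀ k {m} {I : Set} (σ : I → Rel (Carrier A) m lzero) → I →
    (∀ i j → Σ I λ l → (σ i ⊆ᴿ σ l) × (σ j ⊆ᴿ σ l)) →
    (∀ i → LocallyClosed k (σ i)) → LocallyClosed k (λ a → Σ I λ i → σ i a)
  LocallyClosed-⋃-directed k σ i₀ directed σ-closed τ τ⊆⋃ b entails =
    let l , τ⊆σl = All-directed-⋃ σ i₀ directed τ τ⊆⋃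
    in l , σ-closed l τ τ⊆σl b entails

  -- b ∈ Tppk(τ)^A = Tpp(τ)^A, the least closed relation containing τ.
  InClosure⇒LocallyClosed : ∀ k m →
    (∀ (τ : List (Vec (Carrier A) (suc m))) → (Tpp A (fin τ) ^ A) ≐ (Tppk A k (fin τ) ^ A)) →
    ∀ {σ} → InClosure A m σ → LocallyClosed k σ
  InClosure⇒LocallyClosed k m Tpp≐Tppk (Ψ , σ⊆Ψ , Ψ⊆σ) τ τ⊆σ b entails =
    Ψ⊆σ b (Tpp^-least (λ a a∈τ → σ⊆Ψ a (All.lookup τ⊆σ a∈τ)) b b∈Tpp^)
    where
    b∈Tpp^ = proj₂ (Tpp≐Tppk τ) b (Equivalence.from (Tppk^⇔Tppk-⊆-sing k (fin τ) b) entails)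

  -- σ is the directed union of the closed relations Tpp(τ)^A over finite τ ⊆ σ.
  LocallyClosed⇒InClosure : ∀ k m → Algebraic A →
    ∀ {σ} → LocallyClosed k σ → InClosure A m σ
  LocallyClosed⇒InClosure k m algebraic {σ} σ-closed =
    InClosure-resp-≐ (σ⊆⋃ , ⋃⊆σ)
      (algebraic m FinSub hull ([] , []) hull-directed (λ (τ , _) → Tpp^-closed m (fin τ)))
    where
    FinSub = Σ (List (Vec (Carrier A) (suc m))) (All σ)

    hull : FinSub → Rel (Carrier A) (suc m) lzero
    hull (τ , _) = Tpp A (fin τ) ^ A

    hull-directed : ∀ p q → Σ FinSub λ r → (hull p ⊆ᴿ hull r) × (hull q ⊆ᴿ hull r)
    hull-directed (τ , τ⊆σ) (τ′ , τ′⊆σ) =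
      (τ ++ τ′ , ++⁺ τ⊆σ τ′⊆σ) , Tpp^-mono (λ _ → ∈-++⁺ˡ) , Tpp^-mono (λ _ → ∈-++⁺ʳ τ)

    σ⊆⋃ : σ ⊆ᴿ (λ a → Σ FinSub λ p → hull p a)
    σ⊆⋃ a a∈σ = (a ∷ [] , a∈σ ∷ []) , ⊆-Tpp^ (fin (a ∷ [])) a (here refl)

    ⋃⊆σ : (λ a → Σ FinSub λ p → hull p a) ⊆ᴿ σ
    ⋃⊆σ b ((τ , τ⊆σ) , b∈hull) =
      σ-closed τ τ⊆σ b
        (Equivalence.to (Tppk^⇔Tppk-⊆-sing k (fin τ) b) (Tpp^⊆Tppk^ k (fin τ) b b∈hull))

  module _ {k : ℕ} (polylocal : Polylocal A k) where

    polylocal⇒algebraic : Algebraic A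
    polylocal⇒algebraic m I σ i₀ directed σ-closed =
      proj₂ (polylocal m _)
        (LocallyClosed-⋃-directed k σ i₀ directed (λ i → proj₁ (polylocal m (σ i)) (σ-closed i)))

    polylocal⇒Tpp^≐Tppk^ : ∀ m (τ : List (Vec (Carrier A) (suc m))) →
      (Tpp A (fin τ) ^ A) ≐ (Tppk A k (fin τ) ^ A)
    polylocal⇒Tpp^≐Tppk^ m τ =
      Tpp^⊆Tppk^ k (fin τ) ,
      λ b b∈ → proj₁ (polylocal m _) (Tpp^-closed m (fin τ)) τ
                 (All.tabulate (λ a∈τ → ⊆-Tpp^ (fin τ) _ a∈τ)) b
                 (Equivalence.to (Tppk^⇔Tppk-⊆-sing k (fin τ) b) b∈)

mainTheorem20 : (S : Signature) (A : Structure S) (k : ℕ) →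
    Polylocal A k
    ⇔ (Algebraic A ×
       (∀ (m : ℕ) (τ : List (Vec (Carrier A) (suc m))) →
          (Tpp A (fin τ) ^ A) ≐ (Tppk A k (fin τ) ^ A)))
mainTheorem20 S A k = mk⇔
  (λ polylocal → polylocal⇒algebraic A polylocal , polylocal⇒Tpp^≐Tppk^ A polylocal)
  (λ (algebraic , Tpp≐Tppk) m σ →
     InClosure⇒LocallyClosed A k m (Tpp≐Tppk m) , LocallyClosed⇒InClosure A k m algebraic)
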